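{- For every positive integer $n$, $f_2(n;2) \leq \left\lceil\left(2 + \sqrt{2}\right)^n\right\rceil$.
   Context: Let $\chi:\binom{[N]}{k}\to\{1,\dots,q\}$ be a coloring of the $k$-subsets of $[N]=\{1,\dots,N\}$. A set $T\subseteq[N]$ is nonincreasing if for every $v_1<\cdots<v_{k+1}$ in $T$ we have $\chi(v_1,\dots,v_k)\ge \chi(v_2,\dots,v_{k+1})$. $f_k(n;q)$ is the minimum integer $N$ such that every coloring of the $k$-subsets of $[N]$ with colors $\{1,\dots,q\}$ contains a nonincreasing set of size $n$. -}

module Defs where

open import Data.Nat using (ℕ; zero; suc; _+_; _*_; _∸_; _^_; _≤_; _<_)
open import Data.Fin using (Fin; toℕ)
open import Data.Product using (_×_; _,_; Σ; ∃)

-- Colourings of the 2-subsets of [N] (vertex set Fin N, natural order) with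
-- q colours; colours are Fin q, ordered via toℕ.  χ i j is only consulted
-- for i < j, i.e. it encodes χ({i,j}).
Colouring : ℕ → ℕ → Set
Colouring N q = Fin N → Fin N → Fin q

-- A set T ⊆ [N] of size n, listed increasingly as v : Fin n → Fin N.
StrictlyIncreasing : ∀ {n N} → (Fin n → Fin N) → Set
StrictlyIncreasing {n} v = ∀ (a b : Fin n) → toℕ a < toℕ b → toℕ (v a) < toℕ (v b)

Nonincreasing : ∀ {n N q} → Colouring N q → (Fin n → Fin N) → Set
Nonincreasing {n} χ v =
  ∀ (a b c : Fin n) → toℕ a < toℕ b → toℕ b < toℕ c →
    toℕ (χ (v b) (v c)) ≤ toℕ (χ (v a) (v b))

Arrows₂ : ℕ → ℕ → ℕ → Set
Arrows₂ N n q = (χ : Colouring N q) →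
  Σ (Fin n → Fin N) λ v → StrictlyIncreasing v × Nonincreasing χ v

-- f₂(n;q) ≤ M  :⟺  the minimum N with Arrows₂ N n q is at most M.
f₂≤ : ℕ → ℕ → ℕ → Set
f₂≤ n q M = Σ ℕ λ N → N ≤ M × Arrows₂ N n q

-- (2 + √2)^n = fst + snd·√2 with natural numbers fst, snd (exact arithmetic
-- in ℤ[√2]):  (p + q√2)(2 + √2) = (2p + 2q) + (p + 2q)√2.
pow2+√2 : ℕ → ℕ × ℕ
pow2+√2 zero = 1 , 0
pow2+√2 (suc n) with pow2+√2 n
... | p , q = (2 * p + 2 * q) , (p + 2 * q)

-- M ≥ p + q√2 (as real numbers), for natural M, p, q:
-- ⟺ M ≥ p and (M - p)² ≥ 2q².
GeP+Q√2 : ℕ → ℕ × ℕ → Set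
GeP+Q√2 M (p , q) = p ≤ M × 2 * (q * q) ≤ (M ∸ p) * (M ∸ p)

Ge2+√2^ : ℕ → ℕ → Set
Ge2+√2^ M n = GeP+Q√2 M (pow2+√2 n)

-- M = ⌈(2 + √2)^n⌉ : the least natural number ≥ (2 + √2)^n
-- (the value is ≥ 1, so this is the ceiling).
IsCeil2+√2^ : ℕ → ℕ → Set
IsCeil2+√2^ n M = Ge2+√2^ M n × (∀ K → Ge2+√2^ K n → M ≤ K)

-- Colour the pair {x, y} "red" when χ(x, y) = 2.  A red clique P followed by
-- a blue clique S is nonincreasing, and such a set of size n exists among
-- n·2ⁿ⁻¹ vertices: cut them into n blocks of 2ⁿ⁻¹; if the first k blocks
-- contain a red k-clique K, then Ramsey's bound R(k+1, n−k) ≤ 2ⁿ⁻¹ in the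
-- next block yields either a red (k+1)-clique or a blue (n−k)-clique S, and
-- then K ++ S will do.  Finally n·2ⁿ⁻¹ is at most the rational part of
-- (2 + √2)ⁿ, hence at most its ceiling.
module Submission where

open import Defs
open import Data.Nat using (ℕ; zero; suc; _+_; _*_; _∸_; _^_; _≤_; _<_; z≤n; s≤s; s≤s⁻¹; _≤?_)
open import Data.Nat.Properties
open import Data.Nat.Tactic.RingSolver using (solve-∀)
open import Data.Fin using (Fin; toℕ) renaming (zero to fzero; suc to fsuc)
open import Data.Fin.Properties using (toℕ≤pred[n])
open import Data.List using (List; []; _∷_; _++_; length; map; filter; take; drop; allFin; lookup)
open import Data.List.Properties using (length-++; length-map; length-take; length-drop; length-tabulate; take++drop≡id; ++-identityʳ; map-++; map-∘; map-id)
open import Data.List.Membership.Propositional.Properties using (∈-lookup)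
open import Data.List.Relation.Unary.All as All using (All; []; _∷_)
open import Data.List.Relation.Unary.All.Properties using (all-filter)
import Data.List.Relation.Unary.All.Properties as Allₚ
open import Data.List.Relation.Unary.AllPairs using (AllPairs; []; _∷_)
import Data.List.Relation.Unary.AllPairs as AllPairs
import Data.List.Relation.Unary.AllPairs.Properties as AllPairsₚ
open import Data.List.Relation.Binary.Sublist.Propositional using (_⊆_; []; _∷_; _∷ʳ_; minimum; ⊆-trans)
open import Data.List.Relation.Binary.Sublist.Propositional.Properties using (All-resp-⊆; filter-⊆; take-⊆; drop-⊆)
import Data.List.Relation.Binary.Sublist.Propositional.Properties as Sublist
open import Data.Product using (Σ; Σ-syntax; _×_; _,_; proj₁; proj₂)
open import Data.Sum using (_⊎_; inj₁; inj₂)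
import Data.Sum as Sum
open import Data.Empty using (⊥-elim)
open import Function using (id; _∘_; _on_)
open import Relation.Binary.Definitions using (Decidable)
open import Relation.Binary.PropositionalEquality using (_≡_; refl; sym; trans; cong; cong₂; subst; module ≡-Reasoning)
open import Relation.Nullary using (¬_; yes; no)
open import Relation.Unary.Properties using (∁?)
import Relation.Unary as U

private
  variable
    A : Set

pigeonhole : ∀ m k l → 2 * m ≤ suc (k + l) → m ≤ k ⊎ m ≤ l
pigeonhole m k l h with m ≤? k
... | yes m≤k = inj₁ m≤k
... | no m≰k = inj₂ (+-cancelˡ-≤ (suc k) m l (begin
  suc k + m      ≤⟨ +-monoˡ-≤ m (≰⇒> m≰k) ⟩
  m + m          ≡⟨ cong (m +_) (sym (+-identityʳ m)) ⟩
  2 * m          ≤⟨ h ⟩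
  suc k + l      ∎))
  where open ≤-Reasoning

length-filter+length-filter-∁ : ∀ {P : A → Set} (P? : U.Decidable P) xs →
  length (filter P? xs) + length (filter (∁? P?) xs) ≡ length xs
length-filter+length-filter-∁ P? [] = refl
length-filter+length-filter-∁ P? (x ∷ xs) with P? x
... | yes _ = cong suc (length-filter+length-filter-∁ P? xs)
... | no _ = trans (+-suc _ _) (cong suc (length-filter+length-filter-∁ P? xs))

AllPairs-resp-⊆ : ∀ {R : A → A → Set} {xs ys} → xs ⊆ ys → AllPairs R ys → AllPairs R xs
AllPairs-resp-⊆ [] [] = []
AllPairs-resp-⊆ (y ∷ʳ xs⊆ys) (_ ∷ Rys) = AllPairs-resp-⊆ xs⊆ys Rys
AllPairs-resp-⊆ (refl ∷ xs⊆ys) (Ry ∷ Rys) = All-resp-⊆ xs⊆ys Ry ∷ AllPairs-resp-⊆ xs⊆ys Rys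

AllPairs-lookup : ∀ {R : A → A → Set} {xs} → AllPairs R xs →
  ∀ {i j : Fin (length xs)} → toℕ i < toℕ j → R (lookup xs i) (lookup xs j)
AllPairs-lookup (Rx ∷ _) {fzero} {fsuc j} _ = All.lookup Rx (∈-lookup j)
AllPairs-lookup (_ ∷ Rxs) {fsuc i} {fsuc j} i<j = AllPairs-lookup Rxs (s≤s⁻¹ i<j)

HasSublist : (List A → Set) → ℕ → List A → Set
HasSublist {A} P k xs = Σ[ ys ∈ List A ] ys ⊆ xs × P ys × length ys ≡ k

HasSublist-mono : ∀ {P : List A → Set} {k xs zs} → xs ⊆ zs → HasSublist P k xs → HasSublist P k zs
HasSublist-mono xs⊆zs (ys , ys⊆xs , Pys , |ys|) = ys , ⊆-trans ys⊆xs xs⊆zs , Pys , |ys|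

HasSublist-∷ : ∀ {R : A → A → Set} {k} x {zs xs} → zs ⊆ xs → All (R x) zs →
  HasSublist (AllPairs R) k zs → HasSublist (AllPairs R) (suc k) (x ∷ xs)
HasSublist-∷ x zs⊆xs Rxzs (ys , ys⊆zs , Rys , |ys|) =
  x ∷ ys , refl ∷ ⊆-trans ys⊆zs zs⊆xs , All-resp-⊆ ys⊆zs Rxzs ∷ Rys , cong suc |ys|

module Ramsey {V : Set} {E : V → V → Set} (E? : Decidable E) where

  Clique Independent : List V → Set
  Clique = AllPairs E
  Independent = AllPairs (λ x y → ¬ E x y)

  CliqueThenIndependent : List V → Set
  CliqueThenIndependent ys = Σ[ P ∈ List V ] Σ[ S ∈ List V ] ys ≡ P ++ S × Clique P × Independent S

  neighbours nonNeighbours : V → List V → List V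
  neighbours x = filter (E? x)
  nonNeighbours x = filter (∁? (E? x))

  ramsey : ∀ a b xs → 2 ^ (a + b) ≤ length xs →
    HasSublist Clique (suc a) xs ⊎ HasSublist Independent (suc b) xs
  ramsey a b [] h = ⊥-elim (<⇒≱ (m^n>0 2 (a + b)) h)
  ramsey zero b (x ∷ xs) _ = inj₁ (x ∷ [] , refl ∷ minimum xs , [] ∷ [] , refl)
  ramsey (suc a) zero (x ∷ xs) _ = inj₂ (x ∷ [] , refl ∷ minimum xs , [] ∷ [] , refl)
  ramsey (suc a) (suc b) (x ∷ xs) h
    with pigeonhole (2 ^ (a + suc b)) (length (neighbours x xs)) (length (nonNeighbours x xs))
           (subst (λ l → 2 ^ suc (a + suc b) ≤ suc l) (sym (length-filter+length-filter-∁ (E? x) xs)) h)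
  ... | inj₁ h₁ =
    Sum.map (HasSublist-∷ x (filter-⊆ (E? x) xs) (all-filter (E? x) xs))
            (HasSublist-mono (x ∷ʳ filter-⊆ (E? x) xs))
      (ramsey a (suc b) (neighbours x xs) h₁)
  ... | inj₂ h₂ =
    Sum.map (HasSublist-mono (x ∷ʳ filter-⊆ (∁? (E? x)) xs))
            (HasSublist-∷ x (filter-⊆ (∁? (E? x)) xs) (all-filter (∁? (E? x)) xs))
      (ramsey (suc a) b (nonNeighbours x xs)
        (subst (λ e → 2 ^ e ≤ length (nonNeighbours x xs)) (+-suc a b) h₂))

  cliqueOrCliqueThenIndependent : ∀ m k → k ≤ suc m → ∀ xs → k * 2 ^ m ≤ length xs →
    HasSublist Clique k xs ⊎ HasSublist CliqueThenIndependent (suc m) xs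
  cliqueOrCliqueThenIndependent m zero _ xs _ = inj₁ ([] , minimum xs , [] , refl)
  cliqueOrCliqueThenIndependent m (suc k) k<1+m xs h
    with cliqueOrCliqueThenIndependent m k (<⇒≤ k<1+m) (take t xs) prefix-long
    where
    t = k * 2 ^ m
    prefix-long : t ≤ length (take t xs)
    prefix-long = ≤-reflexive (sym (trans (length-take t xs) (m≤n⇒m⊓n≡m (m+n≤o⇒n≤o (2 ^ m) h))))
  ... | inj₂ split = inj₂ (HasSublist-mono (take-⊆ (k * 2 ^ m) xs) split)
  ... | inj₁ (K , K⊆ , cK , |K|)
    with ramsey k (m ∸ k) (drop (k * 2 ^ m) xs) block-long
    where
    k+[m∸k]≡m : k + (m ∸ k) ≡ m
    k+[m∸k]≡m = m+[n∸m]≡n (s≤s⁻¹ k<1+m)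
    block-long : 2 ^ (k + (m ∸ k)) ≤ length (drop (k * 2 ^ m) xs)
    block-long rewrite k+[m∸k]≡m | length-drop (k * 2 ^ m) xs = m+n≤o⇒m≤o∸n (2 ^ m) h
  ... | inj₁ clique = inj₁ (HasSublist-mono (drop-⊆ (k * 2 ^ m) xs) clique)
  ... | inj₂ (S , S⊆ , iS , |S|) =
    inj₂ ( K ++ S
         , subst (K ++ S ⊆_) (take++drop≡id (k * 2 ^ m) xs) (Sublist.++⁺ K⊆ S⊆)
         , (K , S , refl , cK , iS)
         , |K++S|)
    where
    open ≡-Reasoning
    |K++S| : length (K ++ S) ≡ suc m
    |K++S| = begin
      length (K ++ S)          ≡⟨ length-++ K ⟩
      length K + length S      ≡⟨ cong₂ _+_ |K| |S| ⟩
      k + suc (m ∸ k)          ≡⟨ +-suc k (m ∸ k) ⟩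
      suc (k + (m ∸ k))        ≡⟨ cong suc (m+[n∸m]≡n (s≤s⁻¹ k<1+m)) ⟩
      suc m                    ∎

  cliqueThenIndependent : ∀ m xs → suc m * 2 ^ m ≤ length xs →
    HasSublist CliqueThenIndependent (suc m) xs
  cliqueThenIndependent m xs h with cliqueOrCliqueThenIndependent m (suc m) ≤-refl xs h
  ... | inj₂ split = split
  ... | inj₁ (P , P⊆ , cP , |P|) = P , P⊆ , (P , [] , sym (++-identityʳ P) , cP , []) , |P|

module _ {N q : ℕ} (χ : Colouring N q) where

  NonincreasingSet : ℕ → Set
  NonincreasingSet n = Σ (Fin n → Fin N) λ v → StrictlyIncreasing v × Nonincreasing χ v

  -- If each vertex y carries a label t and every pair x < y has its colour
  -- between the labels of y and of x, then χ(y, z) ≤ t ≤ χ(x, y).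
  Banded : Fin q × Fin N → Fin q × Fin N → Set
  Banded (s , x) (t , y) = toℕ t ≤ toℕ (χ x y) × toℕ (χ x y) ≤ toℕ s

  nonincreasing-if-banded : (L : List (Fin q × Fin N)) →
    AllPairs (_<_ on (toℕ ∘ proj₂)) L → AllPairs Banded L → NonincreasingSet (length L)
  nonincreasing-if-banded L sorted banded =
    proj₂ ∘ lookup L ,
    (λ a b a<b → AllPairs-lookup sorted a<b) ,
    (λ a b c a<b b<c →
      ≤-trans (proj₂ (AllPairs-lookup banded b<c)) (proj₁ (AllPairs-lookup banded a<b)))

map-proj₂-map-, : ∀ {B : Set} (b : B) (xs : List A) → map proj₂ (map (b ,_) xs) ≡ xs
map-proj₂-map-, b xs = trans (sym (map-∘ xs)) (map-id xs)

module _ {N : ℕ} (χ : Colouring N 2) where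

  open Ramsey (λ x y → 1 ≤? toℕ (χ x y))

  label : List (Fin N) → List (Fin N) → List (Fin 2 × Fin N)
  label P S = map (fsuc fzero ,_) P ++ map (fzero ,_) S

  map-proj₂-label : ∀ P S → map proj₂ (label P S) ≡ P ++ S
  map-proj₂-label P S =
    trans (map-++ proj₂ (map (fsuc fzero ,_) P) _) (cong₂ _++_ (map-proj₂-map-, _ P) (map-proj₂-map-, _ S))

  banded-label : ∀ {P S} → Clique P → Independent S → AllPairs (Banded χ) (label P S)
  banded-label {P} {S} cP iS = AllPairsₚ.++⁺
    (AllPairsₚ.map⁺ (AllPairs.map (λ {x} {y} red → red , toℕ≤pred[n] (χ x y)) cP))
    (AllPairsₚ.map⁺ (AllPairs.map (λ notRed → z≤n , ≮⇒≥ notRed) iS))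
    (Allₚ.map⁺ (All.universal (λ x →
      Allₚ.map⁺ (All.universal (λ y → z≤n , toℕ≤pred[n] (χ x y)) S)) P))

  nonincreasing-if-cliqueThenIndependent : ∀ {ys} → ys ⊆ allFin N →
    CliqueThenIndependent ys → NonincreasingSet χ (length ys)
  nonincreasing-if-cliqueThenIndependent ys⊆ (P , S , refl , cP , iS) =
    subst (NonincreasingSet χ) |label|
      (nonincreasing-if-banded χ (label P S) sorted (banded-label cP iS))
    where
    sorted : AllPairs (_<_ on (toℕ ∘ proj₂)) (label P S)
    sorted = AllPairsₚ.map⁻ (subst (AllPairs (_<_ on toℕ)) (sym (map-proj₂-label P S))
      (AllPairs-resp-⊆ ys⊆ (AllPairsₚ.tabulate⁺-< id)))
    |label| : length (label P S) ≡ length (P ++ S)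
    |label| = trans (sym (length-map proj₂ (label P S))) (cong length (map-proj₂-label P S))

  nonincreasingSet : ∀ m → suc m * 2 ^ m ≤ N → NonincreasingSet χ (suc m)
  nonincreasingSet m h
    with cliqueThenIndependent m (allFin N) (subst (_ ≤_) (sym (length-tabulate id)) h)
  ... | ys , ys⊆ , split , |ys| =
    subst (NonincreasingSet χ) |ys| (nonincreasing-if-cliqueThenIndependent ys⊆ split)

pow2+√2-snd-≥ : ∀ m → 2 ^ m ≤ proj₂ (pow2+√2 (suc m))
pow2+√2-snd-≥ zero = s≤s z≤n
pow2+√2-snd-≥ (suc m) = ≤-trans (*-monoʳ-≤ 2 (pow2+√2-snd-≥ m)) (m≤n+m _ (proj₁ (pow2+√2 (suc m))))

pow2+√2-fst-≥ : ∀ m → suc m * 2 ^ m ≤ proj₁ (pow2+√2 (suc m))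
pow2+√2-fst-≥ zero = s≤s z≤n
pow2+√2-fst-≥ (suc m) = begin
  (2 + m) * (2 * 2 ^ m)                ≡⟨ distrib m (2 ^ m) ⟩
  2 * (suc m * 2 ^ m) + 2 * 2 ^ m      ≤⟨ +-mono-≤ (*-monoʳ-≤ 2 (pow2+√2-fst-≥ m)) (*-monoʳ-≤ 2 (pow2+√2-snd-≥ m)) ⟩
  proj₁ (pow2+√2 (suc (suc m)))        ∎
  where
  open ≤-Reasoning
  distrib : ∀ m t → (2 + m) * (2 * t) ≡ 2 * ((1 + m) * t) + 2 * t
  distrib = solve-∀

theorem4 : (n : ℕ) → 1 ≤ n → (M : ℕ) → IsCeil2+√2^ n M → f₂≤ n 2 M
theorem4 zero () _ _
theorem4 (suc m) _ M ((p≤M , _) , _) =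
  suc m * 2 ^ m , ≤-trans (pow2+√2-fst-≥ m) p≤M , λ χ → nonincreasingSet χ m ≤-refl
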